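{- The fixed point problem is reducible to the common term problem: for every equational theory $E$ and every substitution $\theta$ whose domain $\{x_1,\dots,x_n\}$ is finite and nonempty, one can effectively construct ground substitutions $\theta_1,\theta_2$ with domain $\{x_1,\dots,x_n\}$ (over the signature of $E$ extended with fresh constants) such that there is a non-ground term $t \in T(\mathrm{Sig}(E), \{x_1,\dots,x_n\})$ with $\theta(t) \approx_E t$ if and only if there is a non-ground term $t \in T(\mathrm{Sig}(E), \{x_1,\dots,x_n\})$ with $\theta_1(t) \approx_E \theta_2(t)$.
   Context: $T(\Sigma, X)$ is the set of terms over signature $\Sigma$ and variables $X$; $\mathrm{Sig}(E)$ is the signature of $E$; $\approx_E$ is equality modulo the equational theory $E$. A substitution is ground if the terms in its range contain no variables. The fixed point problem asks, for $\theta$ and $E$, whether some non-ground $t \in T(\mathrm{Sig}(E), \mathrm{Dom}(\theta))$ satisfies $\theta(t)\approx_E t$; the common term problem asks, for ground $\theta_1,\theta_2$ and $E$, whether some non-ground $t \in T(\mathrm{Sig}(E), \mathrm{Dom}(\theta_1)\cup\mathrm{Dom}(\theta_2))$ satisfies $\theta_1(t)\approx_E\theta_2(t)$. -}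

module Defs where

open import Data.Nat using (ℕ)
open import Data.Fin using (Fin)
open import Data.Sum using (_⊎_; inj₁; inj₂)
open import Data.Empty using (⊥)
open import Data.Product using (Σ; ∃; _,_)

record Signature : Set₁ where
  constructor sig
  field
    Sym   : Set
    arity : Sym → ℕ
open Signature public

data Term (S : Signature) (V : Set) : Set where
  var : V → Term S V
  app : (f : Sym S) → (Fin (arity S f) → Term S V) → Term S V

_⟪_⟫ : ∀ {S V W} → Term S V → (V → Term S W) → Term S W
var x     ⟪ σ ⟫ = σ x
app f ts  ⟪ σ ⟫ = app f (λ i → ts i ⟪ σ ⟫)

data _occursIn_ {S V} (x : V) : Term S V → Set where
  here  : x occursIn var x
  there : ∀ {f ts} (i : Fin (arity S f)) → x occursIn ts i → x occursIn app f ts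

NonGround : ∀ {S V} → Term S V → Set
NonGround {V = V} t = ∃ λ (x : V) → x occursIn t

-- An equational theory E over signature S: a family of identities
-- lhs i ≈ rhs i between terms over the countable variable set ℕ.
-- Sig(E) = S.
record Theory (S : Signature) : Set₁ where
  constructor theory
  field
    Ax  : Set
    lhs : Ax → Term S ℕ
    rhs : Ax → Term S ℕ
open Theory public

data _⊢_≈_ {S : Signature} (E : Theory S) {V : Set} : Term S V → Term S V → Set where
  ax    : (a : Ax E) (σ : ℕ → Term S V) → E ⊢ (lhs E a ⟪ σ ⟫) ≈ (rhs E a ⟪ σ ⟫)
  ≈refl  : ∀ {t} → E ⊢ t ≈ t
  ≈sym   : ∀ {t u} → E ⊢ t ≈ u → E ⊢ u ≈ t
  ≈trans : ∀ {t u v} → E ⊢ t ≈ u → E ⊢ u ≈ v → E ⊢ t ≈ v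
  ≈cong  : ∀ f {ts us} → (∀ i → E ⊢ ts i ≈ us i) → E ⊢ app f ts ≈ app f us

_⊕_ : Signature → Set → Signature
S ⊕ C = sig (Sym S ⊎ C) ar
  where
  ar : Sym S ⊎ C → ℕ
  ar (inj₁ f) = arity S f
  ar (inj₂ _) = 0

embed : ∀ {S C V} → Term S V → Term (S ⊕ C) V
embed (var x)    = var x
embed (app f ts) = app (inj₁ f) (λ i → embed (ts i))

_⁺_ : ∀ {S} → Theory S → (C : Set) → Theory (S ⊕ C)
E ⁺ C = theory (Ax E) (λ a → embed (lhs E a)) (λ a → embed (rhs E a))

rename : ∀ {S V W} → (V → W) → Term S V → Term S W
rename ρ t = t ⟪ (λ x → var (ρ x)) ⟫

-- Fixed point problem instance: θ with domain {x_1..x_n} (= Fin n), whose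
-- range may contain further variables from Y.  Solvable iff some non-ground
-- t ∈ T(Sig(E), {x_1..x_n}) has θ(t) ≈_E t.
FixedPointSolvable : ∀ {S} (E : Theory S) {Y : Set} (n : ℕ)
                     → (Fin n → Term S (Fin n ⊎ Y)) → Set
FixedPointSolvable E n θ =
  Σ (Term _ (Fin n)) λ t → NonGround t × (E ⊢ (t ⟪ θ ⟫) ≈ rename inj₁ t)
  where open import Data.Product using (_×_)

GroundSubst : Signature → ℕ → Set
GroundSubst S n = Fin n → Term S ⊥

CommonTermSolvable : ∀ {S} (E : Theory S) (C : Set) (n : ℕ)
                     → GroundSubst (S ⊕ C) n → GroundSubst (S ⊕ C) n → Set
CommonTermSolvable {S} E C n θ₁ θ₂ =
  Σ (Term S (Fin n)) λ t → NonGround t × ((E ⁺ C) ⊢ (embed t ⟪ θ₁ ⟫) ≈ (embed t ⟪ θ₂ ⟫))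
  where open import Data.Product using (_×_)

{-# OPTIONS --safe #-}
-- Freeze every variable that θ may introduce, and every x_i, into a fresh
-- constant; let θ₁ be θ followed by freezing and θ₂ send x_i to its constant.
-- Then θ₁(t) is the frozen θ(t) and θ₂(t) the frozen t.  Freezing preserves
-- equality modulo E, and it also reflects it: thawing the constants back into
-- variables inverts it, because no identity of E mentions the fresh constants.
module Submission where

open import Defs
open import Data.Nat using (ℕ; _<_)
open import Data.Fin using (Fin)
open import Data.Sum using (_⊎_; inj₁; inj₂)
open import Data.Product using (Σ-syntax; _,_)
open import Data.Empty using (⊥)
open import Function.Base using (_∘_)
open import Function.Bundles using (_⇔_; mk⇔; module Equivalence)
open import Function.Properties.Equivalence using () renaming (trans to ⇔-trans)
open import Relation.Binary.PropositionalEquality using (_≢_)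

module _ {S : Signature} (E : Theory S) where

  ⟪⟫-assoc : ∀ {V W U} (t : Term S V) (σ : V → Term S W) (τ : W → Term S U)
           → E ⊢ (t ⟪ σ ⟫) ⟪ τ ⟫ ≈ (t ⟪ (λ x → σ x ⟪ τ ⟫) ⟫)
  ⟪⟫-assoc (var x)    σ τ = ≈refl
  ⟪⟫-assoc (app f ts) σ τ = ≈cong f (λ i → ⟪⟫-assoc (ts i) σ τ)

  ⟪⟫-identity : ∀ {V} (t : Term S V) → E ⊢ t ⟪ var ⟫ ≈ t
  ⟪⟫-identity (var x)    = ≈refl
  ⟪⟫-identity (app f ts) = ≈cong f (λ i → ⟪⟫-identity (ts i))

  ⟪⟫-congʳ : ∀ {V W} (t : Term S V) {σ τ : V → Term S W}
           → (∀ x → E ⊢ σ x ≈ τ x) → E ⊢ t ⟪ σ ⟫ ≈ (t ⟪ τ ⟫)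
  ⟪⟫-congʳ (var x)    σ≈τ = σ≈τ x
  ⟪⟫-congʳ (app f ts) σ≈τ = ≈cong f (λ i → ⟪⟫-congʳ (ts i) σ≈τ)

  ⟪⟫-congˡ : ∀ {V W} {u v : Term S V} (ρ : V → Term S W)
           → E ⊢ u ≈ v → E ⊢ u ⟪ ρ ⟫ ≈ (v ⟪ ρ ⟫)
  ⟪⟫-congˡ ρ (ax a σ)     = ≈trans (⟪⟫-assoc (lhs E a) σ ρ)
                              (≈trans (ax a (λ x → σ x ⟪ ρ ⟫)) (≈sym (⟪⟫-assoc (rhs E a) σ ρ)))
  ⟪⟫-congˡ ρ ≈refl        = ≈refl
  ⟪⟫-congˡ ρ (≈sym p)     = ≈sym (⟪⟫-congˡ ρ p)
  ⟪⟫-congˡ ρ (≈trans p q) = ≈trans (⟪⟫-congˡ ρ p) (⟪⟫-congˡ ρ q)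
  ⟪⟫-congˡ ρ (≈cong f ps) = ≈cong f (λ i → ⟪⟫-congˡ ρ (ps i))

module _ {S : Signature} {C : Set} where

  embed-⟪⟫ : ∀ {V W} (F : Theory (S ⊕ C)) (t : Term S V) (σ : V → Term S W)
           → F ⊢ embed (t ⟪ σ ⟫) ≈ (embed t ⟪ embed ∘ σ ⟫)
  embed-⟪⟫ F (var x)    σ = ≈refl
  embed-⟪⟫ F (app f ts) σ = ≈cong (inj₁ f) (λ i → embed-⟪⟫ F (ts i) σ)

  embed-≈ : ∀ {V} (E : Theory S) {u v : Term S V}
          → E ⊢ u ≈ v → (E ⁺ C) ⊢ embed u ≈ embed v
  embed-≈ E (ax a σ)     = ≈trans (embed-⟪⟫ (E ⁺ C) (lhs E a) σ)
                             (≈trans (ax a (embed ∘ σ)) (≈sym (embed-⟪⟫ (E ⁺ C) (rhs E a) σ)))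
  embed-≈ E ≈refl        = ≈refl
  embed-≈ E (≈sym p)     = ≈sym (embed-≈ E p)
  embed-≈ E (≈trans p q) = ≈trans (embed-≈ E p) (embed-≈ E q)
  embed-≈ E (≈cong f ps) = ≈cong (inj₁ f) (λ i → embed-≈ E (ps i))

  constant : C → Term (S ⊕ C) ⊥
  constant c = app (inj₂ c) (λ ())

  freeze : Term S C → Term (S ⊕ C) ⊥
  freeze t = embed t ⟪ constant ⟫

  thaw : Term (S ⊕ C) ⊥ → Term S C
  thaw (var ())
  thaw (app (inj₁ f) ts) = app f (λ i → thaw (ts i))
  thaw (app (inj₂ c) _)  = var c

  freeze-⟪⟫ : ∀ {V} (E : Theory S) (t : Term S V) (σ : V → Term S C)
            → (E ⁺ C) ⊢ freeze (t ⟪ σ ⟫) ≈ (embed t ⟪ freeze ∘ σ ⟫)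
  freeze-⟪⟫ E t σ = ≈trans (⟪⟫-congˡ (E ⁺ C) constant (embed-⟪⟫ (E ⁺ C) t σ))
                            (⟪⟫-assoc (E ⁺ C) (embed t) (embed ∘ σ) constant)

  freeze-≈ : (E : Theory S) {u v : Term S C} → E ⊢ u ≈ v → (E ⁺ C) ⊢ freeze u ≈ freeze v
  freeze-≈ E p = ⟪⟫-congˡ (E ⁺ C) constant (embed-≈ E p)

  thaw-embed-⟪⟫ : ∀ {V} (E : Theory S) (t : Term S V) (σ : V → Term (S ⊕ C) ⊥)
                → E ⊢ thaw (embed t ⟪ σ ⟫) ≈ (t ⟪ thaw ∘ σ ⟫)
  thaw-embed-⟪⟫ E (var x)    σ = ≈refl
  thaw-embed-⟪⟫ E (app f ts) σ = ≈cong f (λ i → thaw-embed-⟪⟫ E (ts i) σ)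

  thaw-≈ : (E : Theory S) {u v : Term (S ⊕ C) ⊥} → (E ⁺ C) ⊢ u ≈ v → E ⊢ thaw u ≈ thaw v
  thaw-≈ E (ax a σ)              = ≈trans (thaw-embed-⟪⟫ E (lhs E a) σ)
                                     (≈trans (ax a (thaw ∘ σ)) (≈sym (thaw-embed-⟪⟫ E (rhs E a) σ)))
  thaw-≈ E ≈refl                 = ≈refl
  thaw-≈ E (≈sym p)              = ≈sym (thaw-≈ E p)
  thaw-≈ E (≈trans p q)          = ≈trans (thaw-≈ E p) (thaw-≈ E q)
  thaw-≈ E (≈cong (inj₁ f) ps)   = ≈cong f (λ i → thaw-≈ E (ps i))
  thaw-≈ E (≈cong (inj₂ c) _)    = ≈refl

  thaw-freeze : (E : Theory S) (t : Term S C) → E ⊢ thaw (freeze t) ≈ t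
  thaw-freeze E t = ≈trans (thaw-embed-⟪⟫ E t constant) (⟪⟫-identity E t)

  freeze-≈⇔ : (E : Theory S) {u v : Term S C} → E ⊢ u ≈ v ⇔ (E ⁺ C) ⊢ freeze u ≈ freeze v
  freeze-≈⇔ E {u} {v} = mk⇔ (freeze-≈ E) λ p →
    ≈trans (≈sym (thaw-freeze E u)) (≈trans (thaw-≈ E p) (thaw-freeze E v))

lemmaA1 : (S : Signature) (E : Theory S) (Y : Set) (n : ℕ) → 0 < n
    → (θ : Fin n → Term S (Fin n ⊎ Y))
    → (∀ i → θ i ≢ var (inj₁ i))
    → Σ[ C ∈ Set ] Σ[ θ₁ ∈ GroundSubst (S ⊕ C) n ] Σ[ θ₂ ∈ GroundSubst (S ⊕ C) n ]
    (FixedPointSolvable E n θ ⇔ CommonTermSolvable E C n θ₁ θ₂)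
lemmaA1 S E Y n _ θ _ = (Fin n ⊎ Y) , θ₁ , θ₂ , mk⇔ to from
  where
  θ₁ θ₂ : GroundSubst (S ⊕ (Fin n ⊎ Y)) n
  θ₁ = freeze ∘ θ
  θ₂ = constant ∘ inj₁

  frozen-fixed-point⇔ : ∀ t → (E ⁺ _) ⊢ freeze (t ⟪ θ ⟫) ≈ freeze (rename inj₁ t)
                      ⇔ (E ⁺ _) ⊢ embed t ⟪ θ₁ ⟫ ≈ (embed t ⟪ θ₂ ⟫)
  frozen-fixed-point⇔ t = mk⇔
    (λ p → ≈trans (≈sym (freeze-⟪⟫ E t θ)) (≈trans p (freeze-⟪⟫ E t (var ∘ inj₁))))
    (λ p → ≈trans (freeze-⟪⟫ E t θ) (≈trans p (≈sym (freeze-⟪⟫ E t (var ∘ inj₁)))))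

  fixed⇔common : ∀ t → E ⊢ t ⟪ θ ⟫ ≈ rename inj₁ t ⇔ (E ⁺ _) ⊢ embed t ⟪ θ₁ ⟫ ≈ (embed t ⟪ θ₂ ⟫)
  fixed⇔common t = ⇔-trans (freeze-≈⇔ E) (frozen-fixed-point⇔ t)

  to : FixedPointSolvable E n θ → CommonTermSolvable E (Fin n ⊎ Y) n θ₁ θ₂
  to (t , ng , p) = t , ng , Equivalence.to (fixed⇔common t) p

  from : CommonTermSolvable E (Fin n ⊎ Y) n θ₁ θ₂ → FixedPointSolvable E n θ
  from (t , ng , p) = t , ng , Equivalence.from (fixed⇔common t) p
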